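{- Let $Q$ be a Boolean conjunctive query over a distributed schema, $s$ a source and $\Sigma$ a set of local existential rules. Two $s$-instances are $\Sigma$-invariant shuffle equivalent if and only if they agree on each $\Sigma$-invariant shuffle view of $Q$ for $s$.
   Context: A distributed schema has finitely many sources with pairwise disjoint local schemas $\mathcal{S}_s$; an $s$-instance is an instance of $\mathcal{S}_s$; a context for $s$ is an instance of the other local schemas. Local existential rule: $\forall\vec x(\lambda\to\exists\vec y\rho)$ mentioning relations of one source only. $\mathrm{SJVars}(s,Q)$: variables of $Q$ occurring in an atom over $\mathcal{S}_s$ and in an atom of another source. $\mathrm{CanV}^s(Q)$ (resp. $\mathrm{CanCtxt}^s(Q)$): conjunction of atoms of $Q$ over (resp. not over) $\mathcal{S}_s$ with variables outside $\mathrm{SJVars}(s,Q)$ existentially quantified. A shuffle is $\mu:\mathrm{SJVars}(s,Q)\to\mathrm{SJVars}(s,Q)$ acting by renaming free variables. For a binding $\sigma$ of $\mathrm{SJVars}(s,Q)$, $\mu$ is $\Sigma$-invariant relative to $\langle\sigma,\mathrm{CanCtxt}^s(Q)\rangle$ if every context $C$ satisfying $\Sigma$ with $C,\sigma\models\mathrm{CanCtxt}^s(Q)$ satisfies $C,\sigma\models\mu(\mathrm{CanCtxt}^s(Q))$; for a complete equality type $\tau$ on $\mathrm{SJVars}(s,Q)$, $\mu$ is $\Sigma$-invariant relative to $\tau$ if this holds for every binding $\sigma$ of type $\tau$. $I_1,I_2$ are $\Sigma$-invariant shuffle equivalent if whenever $I_1,\sigma\models\mathrm{CanV}^s(Q)$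 there is $\mu$, $\Sigma$-invariant relative to $\langle\sigma,\mathrm{CanCtxt}^s(Q)\rangle$, with $I_2,\sigma\models\mu(\mathrm{CanV}^s(Q))$, and vice versa. The $\Sigma$-invariant shuffle view for $s,\tau$ is $\tau\wedge\bigvee_\mu\mu(\mathrm{CanV}^s(Q))$, over $\mu$ $\Sigma$-invariant relative to $\tau$; its output is the set of bindings satisfying it. -}

module Defs where

open import Data.Nat using (ℕ)
open import Data.Fin using (Fin; _≟_)
open import Data.Bool using (Bool; true; if_then_else_)
open import Data.Product using (Σ; ∃; ∃-syntax; _×_; _,_; proj₁; proj₂)
open import Data.List using (List; map; filter; _++_)
open import Data.List.Membership.Propositional using (_∈_)
open import Data.List.Relation.Unary.All using (All)
open import Data.List.Relation.Unary.Any using (Any; any?)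
open import Data.Vec using (Vec)
import Data.Vec as Vec
open import Data.Vec.Membership.Propositional using () renaming (_∈_ to _∈ᵥ_)
open import Data.Vec.Membership.DecPropositional (Data.Nat._≟_) using () renaming (_∈?_ to _∈ᵥ?_)
open import Relation.Nullary using (¬_; Dec; does; ¬?)
open import Relation.Nullary.Decidable using (_×-dec_)
open import Relation.Binary.PropositionalEquality using (_≡_; _≢_)

-- A distributed schema: finitely many sources (Fin nsrc), finitely many
-- relation symbols (Fin nrel), each belonging to exactly one source
-- (so the local schemas are pairwise disjoint), each with an arity.
record DSchema : Set where
  field
    nsrc : ℕ
    nrel : ℕ
    src  : Fin nrel → Fin nsrc
    ar   : Fin nrel → ℕ

-- Variables and domain values are both natural numbers
-- (the domain of values is countably infinite).
Var : Set
Var = ℕ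

Val : Set
Val = ℕ

-- A binding assigns values to variables (only values on the relevant
-- variables, here SJVars(s,Q), matter).
Binding : Set
Binding = Var → Val

module _ (𝒮 : DSchema) where
  open DSchema 𝒮

  Atom : Set
  Atom = Σ (Fin nrel) (λ R → Vec Var (ar R))

  Fact : Set
  Fact = Σ (Fin nrel) (λ R → Vec Val (ar R))

  Instance : Set
  Instance = List Fact

  atomSrc : Atom → Fin nsrc
  atomSrc a = src (proj₁ a)

  OccursIn : Var → Atom → Set
  OccursIn x a = x ∈ᵥ proj₂ a

  Occurs : Var → List Atom → Set
  Occurs x as = Any (OccursIn x) as

  inst : (Var → Val) → Atom → Fact
  inst h (R , xs) = R , Vec.map h xs

  SInstance : Fin nsrc → Instance → Set
  SInstance s I = All (λ f → src (proj₁ f) ≡ s) I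

  Context : Fin nsrc → Instance → Set
  Context s C = All (λ f → src (proj₁ f) ≢ s) C

  CQ : Set
  CQ = List Atom

  -- existential rule  ∀x (body → ∃y head); the universally quantified
  -- variables are those of the body, the others in the head are existential
  record Rule : Set where
    field
      body : List Atom
      head : List Atom

  open Rule

  LocalRule : Rule → Set
  LocalRule r = ∃[ t ] All (λ a → atomSrc a ≡ t) (body r ++ head r)

  SatRule : Instance → Rule → Set
  SatRule I r =
    (h : Var → Val) → All (λ a → inst h a ∈ I) (body r) →
    ∃[ h' ] ((∀ x → Occurs x (body r) → h' x ≡ h x)
             × All (λ a → inst h' a ∈ I) (head r))

  -- a context for s satisfies Σ: it satisfies every rule of Σ over the
  -- other sources (the rules over S_s do not concern contexts)
  CtxtSatisfies : Fin nsrc → (Rule → Set) → Instance → Set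
  CtxtSatisfies s Σr C =
    ∀ r → Σr r → All (λ a → atomSrc a ≢ s) (body r ++ head r) → SatRule C r

  module _ (s : Fin nsrc) (Q : CQ) where

    SJ : Var → Set
    SJ x = Any (λ a → atomSrc a ≡ s × OccursIn x a) Q
         × Any (λ a → ¬ (atomSrc a ≡ s) × OccursIn x a) Q

    SJ? : (x : Var) → Dec (SJ x)
    SJ? x = any? (λ a → (atomSrc a ≟ s) ×-dec (x ∈ᵥ? proj₂ a)) Q
      ×-dec any? (λ a → ¬? (atomSrc a ≟ s) ×-dec (x ∈ᵥ? proj₂ a)) Q

    -- atoms of CanV^s(Q) and of CanCtxt^s(Q); the free variables of these
    -- formulas are SJVars(s,Q), all other variables are existentially bound
    CanV : List Atom
    CanV = filter (λ a → atomSrc a ≟ s) Q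

    CanCtxt : List Atom
    CanCtxt = filter (λ a → ¬? (atomSrc a ≟ s)) Q

    Sat : Instance → Binding → List Atom → Set
    Sat I σ as = ∃[ h ] ((∀ x → SJ x → h x ≡ σ x)
                         × All (λ a → inst h a ∈ I) as)

    Shuffle : (Var → Var) → Set
    Shuffle μ = ∀ x → SJ x → SJ (μ x)

    renVar : (Var → Var) → Var → Var
    renVar μ x = if does (SJ? x) then μ x else x

    rename : (Var → Var) → List Atom → List Atom
    rename μ = map (λ a → proj₁ a , Vec.map (renVar μ) (proj₂ a))

    InvariantAt : (Rule → Set) → Binding → (Var → Var) → Set
    InvariantAt Σr σ μ =
      ∀ C → Context s C → CtxtSatisfies s Σr C →
      Sat C σ CanCtxt → Sat C σ (rename μ CanCtxt)

    EqType : (Var → Var → Bool) → Set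
    EqType τ = (∀ x → SJ x → τ x x ≡ true)
             × (∀ x y → SJ x → SJ y → τ x y ≡ true → τ y x ≡ true)
             × (∀ x y z → SJ x → SJ y → SJ z →
                  τ x y ≡ true → τ y z ≡ true → τ x z ≡ true)

    HasType : (Var → Var → Bool) → Binding → Set
    HasType τ σ = ∀ x y → SJ x → SJ y →
                  (σ x ≡ σ y → τ x y ≡ true) × (τ x y ≡ true → σ x ≡ σ y)

    InvariantTy : (Rule → Set) → (Var → Var → Bool) → (Var → Var) → Set
    InvariantTy Σr τ μ = ∀ σ → HasType τ σ → InvariantAt Σr σ μ

    ShuffleEquiv : (Rule → Set) → Instance → Instance → Set
    ShuffleEquiv Σr I₁ I₂ =
      (∀ σ → Sat I₁ σ CanV →
         ∃[ μ ] (Shuffle μ × InvariantAt Σr σ μ × Sat I₂ σ (rename μ CanV)))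
      × (∀ σ → Sat I₂ σ CanV →
         ∃[ μ ] (Shuffle μ × InvariantAt Σr σ μ × Sat I₁ σ (rename μ CanV)))

    -- σ is in the output on I of the Σ-invariant shuffle view for s, τ:
    --   τ ∧ ⋁_{μ Σ-invariant rel. τ} μ(CanV^s(Q))
    ViewOutput : (Rule → Set) → (Var → Var → Bool) → Instance → Binding → Set
    ViewOutput Σr τ I σ =
      HasType τ σ
      × ∃[ μ ] (Shuffle μ × InvariantTy Σr τ μ × Sat I σ (rename μ CanV))

    AgreeOnViews : (Rule → Set) → Instance → Instance → Set
    AgreeOnViews Σr I₁ I₂ =
      ∀ τ → EqType τ → ∀ σ →
      (ViewOutput Σr τ I₁ σ → ViewOutput Σr τ I₂ σ)
      × (ViewOutput Σr τ I₂ σ → ViewOutput Σr τ I₁ σ)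

module Submission where

-- Key fact (InvariantAt-generic): Σ-invariance of a shuffle relative to a
-- binding σ depends only on the equality type of σ on SJVars(s,Q).  Rules
-- are constant-free, so an injective value renaming carries contexts
-- satisfying Σ, and matches of CanCtxt^s(Q), to such; and since SJVars(s,Q)
-- is finite, bindings of the same type are related by such a renaming.
-- Consequently invariant shuffles compose (InvariantTy-∘), using that
-- renaming free variables by a shuffle μ is precomposition with μ.
--   (⇒) If μ puts σ into the view output on I₁, equivalence applied to the
--       match σ ∘ μ of CanV gives ν, and μ ∘ ν puts σ into the output on I₂.
--   (⇐) A match σ of CanV is in the view output for the type of σ via the
--       identity shuffle; the output on the other instance yields the shuffle.

open import Defs
open import Function using (_∘_; id)
open import Data.Fin using (Fin)
open import Data.Bool using (Bool; true; if_then_else_)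
open import Data.Empty using (⊥-elim)
open import Data.Nat using (suc; _+_; _∸_; _<_; s≤s)
import Data.Nat as ℕ
open import Data.Nat.Properties using (m+n∸n≡m; m≤n+m; <-≤-trans; <⇒≢)
open import Data.Product using (∃-syntax; _×_; _,_; proj₁; proj₂)
open import Data.List using (List; concatMap)
import Data.List as List
open import Data.List.Extrema.Nat using (max; xs≤max)
open import Data.List.Membership.Propositional using (_∈_; find; lose)
open import Data.List.Membership.Propositional.Properties using (∈-map⁺; ∈-map⁻; ∈-concat⁺′)
open import Data.List.Relation.Unary.All using (All; lookupAny)
import Data.List.Relation.Unary.All as All
import Data.List.Relation.Unary.All.Properties as All
open import Data.List.Relation.Unary.Any using (any?)
import Data.Vec as Vec
import Data.Vec.Properties as Vec
open import Data.Vec.Membership.Propositional using () renaming (_∈_ to _∈ᵥ_)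
open import Data.Vec.Membership.Propositional.Properties using (∈-toList⁺) renaming (∈-map⁺ to ∈ᵥ-map⁺)
import Data.Vec.Relation.Unary.Any as VecAny
import Data.Vec.Relation.Unary.Any.Properties as VecAny
open import Relation.Nullary using (¬_; Dec; yes; no; does)
open import Relation.Nullary.Decidable using (dec-true; dec-false; map′; _×-dec_)
open import Relation.Binary.PropositionalEquality using (_≡_; refl; sym; trans; cong; subst; module ≡-Reasoning)

if-yes : ∀ {A B : Set} (d : Dec A) {u v : B} → A → (if does d then u else v) ≡ u
if-yes d a rewrite dec-true d a = refl

if-no : ∀ {A B : Set} (d : Dec A) {u v : B} → ¬ A → (if does d then u else v) ≡ v
if-no d ¬a rewrite dec-false d ¬a = refl

does-true : ∀ {A : Set} (d : Dec A) → does d ≡ true → A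
does-true (yes a) _ = a
does-true (no _) ()

module ValueRenaming (𝒮 : DSchema) where

  renameInst : (Val → Val) → Instance 𝒮 → Instance 𝒮
  renameInst f = List.map (inst 𝒮 f)

  inst-∘ : (g h : Val → Val) (a : Atom 𝒮) → inst 𝒮 (g ∘ h) a ≡ inst 𝒮 g (inst 𝒮 h a)
  inst-∘ g h (R , xs) = cong (R ,_) (Vec.map-∘ g h xs)

  module _ (f g : Val → Val) (g∘f≗id : ∀ v → g (f v) ≡ v) where

    inst-leftInverse : (F : Fact 𝒮) → inst 𝒮 g (inst 𝒮 f F) ≡ F
    inst-leftInverse (R , vs) = cong (R ,_) (begin
      Vec.map g (Vec.map f vs) ≡⟨ Vec.map-∘ g f vs ⟨
      Vec.map (g ∘ f) vs       ≡⟨ Vec.map-cong g∘f≗id vs ⟩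
      Vec.map id vs            ≡⟨ Vec.map-id vs ⟩
      vs                       ∎)
      where open ≡-Reasoning

    ∈-renameInst⁺ : ∀ {C h} a → inst 𝒮 h a ∈ C → inst 𝒮 (f ∘ h) a ∈ renameInst f C
    ∈-renameInst⁺ {C} {h} a m =
      subst (_∈ renameInst f C) (sym (inst-∘ f h a)) (∈-map⁺ (inst 𝒮 f) m)

    ∈-renameInst⁻ : ∀ {C h} a → inst 𝒮 h a ∈ renameInst f C → inst 𝒮 (g ∘ h) a ∈ C
    ∈-renameInst⁻ {C} {h} a m with ∈-map⁻ (inst 𝒮 f) m
    ... | F , F∈C , e = subst (_∈ C) F≡ F∈C
      where
      open ≡-Reasoning
      F≡ : F ≡ inst 𝒮 (g ∘ h) a
      F≡ = begin
        F                             ≡⟨ inst-leftInverse F ⟨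
        inst 𝒮 g (inst 𝒮 f F)         ≡⟨ cong (inst 𝒮 g) e ⟨
        inst 𝒮 g (inst 𝒮 h a)         ≡⟨ inst-∘ g h a ⟨
        inst 𝒮 (g ∘ h) a              ∎

    -- Values occurring in f(C) lie in the image of f, so f ∘ g fixes them.
    fixed-inImage : ∀ {w} (F : Fact 𝒮) → w ∈ᵥ proj₂ (inst 𝒮 f F) → f (g w) ≡ w
    fixed-inImage F w∈ with VecAny.satisfied (VecAny.map⁻ w∈)
    ... | v , refl = cong f (g∘f≗id v)

    fixed-onMatches : ∀ {C h x} as → All (λ a → inst 𝒮 h a ∈ renameInst f C) as →
                      Occurs 𝒮 x as → f (g (h x)) ≡ h x
    fixed-onMatches {h = h} {x} as as∈ x∈as with lookupAny as∈ x∈as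
    ... | a∈ , x∈a with ∈-map⁻ (inst 𝒮 f) a∈
    ...   | F , _ , e = fixed-inImage F (subst (λ G → h x ∈ᵥ proj₂ G) e (∈ᵥ-map⁺ h x∈a))

    -- Rules have no constants, hence are preserved by injective renamings.
    SatRule-renameInst : ∀ {C} r → SatRule 𝒮 C r → SatRule 𝒮 (renameInst f C) r
    SatRule-renameInst r sat h body∈ with sat (g ∘ h) (All.map (λ {a} → ∈-renameInst⁻ a) body∈)
    ... | h₀ , h₀≗g∘h , head∈ =
      f ∘ h₀ ,
      (λ x x∈body → trans (cong f (h₀≗g∘h x x∈body)) (fixed-onMatches (Rule.body r) body∈ x∈body)) ,
      All.map (λ {a} → ∈-renameInst⁺ a) head∈

    Context-renameInst : ∀ {s C} → Context 𝒮 s C → Context 𝒮 s (renameInst f C)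
    Context-renameInst = All.map⁺

    CtxtSatisfies-renameInst : ∀ {s Σr C} → CtxtSatisfies 𝒮 s Σr C →
                               CtxtSatisfies 𝒮 s Σr (renameInst f C)
    CtxtSatisfies-renameInst cs r r∈Σ nonlocal = SatRule-renameInst r (cs r r∈Σ nonlocal)

module Satisfaction (𝒮 : DSchema) (s : Fin (DSchema.nsrc 𝒮)) (Q : CQ 𝒮) where
  open ValueRenaming 𝒮

  renVar-SJ : ∀ μ {x} → SJ 𝒮 s Q x → renVar 𝒮 s Q μ x ≡ μ x
  renVar-SJ μ {x} = if-yes (SJ? 𝒮 s Q x)

  renVar-nonSJ : ∀ μ {x} → ¬ SJ 𝒮 s Q x → renVar 𝒮 s Q μ x ≡ x
  renVar-nonSJ μ {x} = if-no (SJ? 𝒮 s Q x)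

  Sat-cong : ∀ {C σ σ' A} → (∀ x → SJ 𝒮 s Q x → σ x ≡ σ' x) →
             Sat 𝒮 s Q C σ A → Sat 𝒮 s Q C σ' A
  Sat-cong σ≗σ' (h , h≗σ , A∈) = h , (λ x x∈ → trans (h≗σ x x∈) (σ≗σ' x x∈)) , A∈

  shuffle-id : Shuffle 𝒮 s Q id
  shuffle-id x x∈ = x∈

  shuffle-∘ : ∀ {μ ν} → Shuffle 𝒮 s Q μ → Shuffle 𝒮 s Q ν → Shuffle 𝒮 s Q (μ ∘ ν)
  shuffle-∘ shμ shν x x∈ = shμ _ (shν x x∈)

  inst-rename : ∀ μ h (a : Atom 𝒮) →
    inst 𝒮 h (proj₁ a , Vec.map (renVar 𝒮 s Q μ) (proj₂ a)) ≡ inst 𝒮 (h ∘ renVar 𝒮 s Q μ) a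
  inst-rename μ h (R , xs) = cong (R ,_) (sym (Vec.map-∘ h (renVar 𝒮 s Q μ) xs))

  Sat-rename⁻ : ∀ {C σ} μ A → Shuffle 𝒮 s Q μ →
                Sat 𝒮 s Q C σ (rename 𝒮 s Q μ A) → Sat 𝒮 s Q C (σ ∘ μ) A
  Sat-rename⁻ {C} μ A shμ (h , h≗σ , A∈) =
    h ∘ renVar 𝒮 s Q μ ,
    (λ x x∈ → trans (cong h (renVar-SJ μ x∈)) (h≗σ (μ x) (shμ x x∈))) ,
    All.map (λ {a} → subst (_∈ C) (inst-rename μ h a)) (All.map⁻ A∈)

  Sat-rename⁺ : ∀ {C σ} μ A → Shuffle 𝒮 s Q μ →
                Sat 𝒮 s Q C (σ ∘ μ) A → Sat 𝒮 s Q C σ (rename 𝒮 s Q μ A)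
  Sat-rename⁺ {C} {σ} μ A shμ (h' , h'≗σ∘μ , A∈) =
    h , h≗σ , All.map⁺ (All.map (λ {a} → subst (_∈ C) (sym (inst-agree a))) A∈)
    where
    -- σ on the free variables, the witness h' on the bound ones
    h : Var → Val
    h x = if does (SJ? 𝒮 s Q x) then σ x else h' x

    h≗σ : ∀ x → SJ 𝒮 s Q x → h x ≡ σ x
    h≗σ x = if-yes (SJ? 𝒮 s Q x)

    h∘renVar≗h' : ∀ y → h (renVar 𝒮 s Q μ y) ≡ h' y
    h∘renVar≗h' y with SJ? 𝒮 s Q y
    ... | yes y∈ = trans (cong h (renVar-SJ μ y∈)) (trans (h≗σ (μ y) (shμ y y∈)) (sym (h'≗σ∘μ y y∈)))
    ... | no y∉ = trans (cong h (renVar-nonSJ μ y∉)) (if-no (SJ? 𝒮 s Q y) y∉)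

    inst-agree : ∀ a → inst 𝒮 h (proj₁ a , Vec.map (renVar 𝒮 s Q μ) (proj₂ a)) ≡ inst 𝒮 h' a
    inst-agree a = trans (inst-rename μ h a) (cong (proj₁ a ,_) (Vec.map-cong h∘renVar≗h' (proj₂ a)))

  module _ (f g : Val → Val) (g∘f≗id : ∀ v → g (f v) ≡ v) where

    Sat-renameInst⁺ : ∀ {C σ A} → Sat 𝒮 s Q C σ A → Sat 𝒮 s Q (renameInst f C) (f ∘ σ) A
    Sat-renameInst⁺ (h , h≗σ , A∈) =
      f ∘ h , (λ x x∈ → cong f (h≗σ x x∈)) , All.map (λ {a} → ∈-renameInst⁺ f g g∘f≗id a) A∈

    Sat-renameInst⁻ : ∀ {C σ A} → Sat 𝒮 s Q (renameInst f C) σ A → Sat 𝒮 s Q C (g ∘ σ) A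
    Sat-renameInst⁻ (h , h≗σ , A∈) =
      g ∘ h , (λ x x∈ → cong g (h≗σ x x∈)) , All.map (λ {a} → ∈-renameInst⁻ f g g∘f≗id a) A∈

module Invariance (𝒮 : DSchema) (s : Fin (DSchema.nsrc 𝒮)) (Q : CQ 𝒮) (Σr : Rule 𝒮 → Set) where
  open ValueRenaming 𝒮
  open Satisfaction 𝒮 s Q

  SameType : Binding → Binding → Set
  SameType σ σ' = ∀ x y → SJ 𝒮 s Q x → SJ 𝒮 s Q y →
                  (σ x ≡ σ y → σ' x ≡ σ' y) × (σ' x ≡ σ' y → σ x ≡ σ y)

  HasType-sameType : ∀ {τ σ σ'} → HasType 𝒮 s Q τ σ → HasType 𝒮 s Q τ σ' → SameType σ σ'
  HasType-sameType σ:τ σ':τ x y x∈ y∈ =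
    proj₂ (σ':τ x y x∈ y∈) ∘ proj₁ (σ:τ x y x∈ y∈) ,
    proj₂ (σ:τ x y x∈ y∈) ∘ proj₁ (σ':τ x y x∈ y∈)

  sameType-shuffle : ∀ {σ σ' μ} → Shuffle 𝒮 s Q μ → SameType σ σ' → SameType (σ ∘ μ) (σ' ∘ μ)
  sameType-shuffle {μ = μ} shμ same x y x∈ y∈ = same (μ x) (μ y) (shμ x x∈) (shμ y y∈)

  -- Invariance is transported along an injective value renaming f sending
  -- σ' to σ on SJVars: a context for σ' is renamed into a context for σ.
  InvariantAt-transport : ∀ {σ σ' ν} (f g : Val → Val) → (∀ v → g (f v) ≡ v) →
    (∀ x → SJ 𝒮 s Q x → f (σ' x) ≡ σ x) →
    InvariantAt 𝒮 s Q Σr σ ν → InvariantAt 𝒮 s Q Σr σ' ν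
  InvariantAt-transport {σ} {σ'} f g g∘f≗id f∘σ'≗σ inv C c cs sat =
    Sat-cong g∘σ≗σ' (Sat-renameInst⁻ f g g∘f≗id
      (inv (renameInst f C) (Context-renameInst f g g∘f≗id c)
           (CtxtSatisfies-renameInst f g g∘f≗id cs)
           (Sat-cong f∘σ'≗σ (Sat-renameInst⁺ f g g∘f≗id sat))))
    where
    g∘σ≗σ' : ∀ x → SJ 𝒮 s Q x → g (σ x) ≡ σ' x
    g∘σ≗σ' x x∈ = trans (cong g (sym (f∘σ'≗σ x x∈))) (g∘f≗id (σ' x))

  -- SJVars(s,Q) is finite: it is contained in the list of variables of Q.
  varsQ : List Var
  varsQ = concatMap (Vec.toList ∘ proj₂) Q

  SJ⊆varsQ : ∀ {x} → SJ 𝒮 s Q x → x ∈ varsQ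
  SJ⊆varsQ (x∈Qₛ , _) with find x∈Qₛ
  ... | a , a∈Q , _ , x∈a = ∈-concat⁺′ (∈-toList⁺ x∈a) (∈-map⁺ (Vec.toList ∘ proj₂) a∈Q)

  Hits : Binding → Val → Set
  Hits σ v = ∃[ x ] (SJ 𝒮 s Q x × σ x ≡ v)

  hits? : ∀ σ v → Dec (Hits σ v)
  hits? σ v = map′ (λ p → let x , _ , q = find p in x , q)
                   (λ (x , q) → lose (SJ⊆varsQ (proj₁ q)) q)
                   (any? (λ x → SJ? 𝒮 s Q x ×-dec (σ x ℕ.≟ v)) varsQ)

  bound : Binding → Val
  bound σ = suc (max 0 (List.map σ varsQ))

  <bound : ∀ σ {x} → SJ 𝒮 s Q x → σ x < bound σ
  <bound σ x∈ = s≤s (All.lookup (All.map⁻ (xs≤max 0 (List.map σ varsQ))) (SJ⊆varsQ x∈))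

  -- Two bindings of the same type are related by an injective value renaming:
  -- f sends σ'(x) to σ(x) for x ∈ SJVars and shifts every other value past
  -- the values of σ on SJVars; g undoes f.
  module Matching (σ σ' : Binding) (same : SameType σ σ') where

    f : Val → Val
    f v with hits? σ' v
    ... | yes (x , _) = σ x
    ... | no _ = v + bound σ

    g : Val → Val
    g w with hits? σ w
    ... | yes (x , _) = σ' x
    ... | no _ = w ∸ bound σ

    f∘σ'≗σ : ∀ x → SJ 𝒮 s Q x → f (σ' x) ≡ σ x
    f∘σ'≗σ x x∈ with hits? σ' (σ' x)
    ... | yes (y , y∈ , σ'y≡σ'x) = proj₂ (same y x y∈ x∈) σ'y≡σ'x
    ... | no miss = ⊥-elim (miss (x , x∈ , refl))

    g∘f≗id : ∀ v → g (f v) ≡ v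
    g∘f≗id v with hits? σ' v
    ... | yes (x , x∈ , σ'x≡v) with hits? σ (σ x)
    ...   | yes (y , y∈ , σy≡σx) = trans (proj₁ (same y x y∈ x∈) σy≡σx) σ'x≡v
    ...   | no miss = ⊥-elim (miss (x , x∈ , refl))
    g∘f≗id v | no _ with hits? σ (v + bound σ)
    ...   | yes (y , y∈ , σy≡) = ⊥-elim (<⇒≢ (<-≤-trans (<bound σ y∈) (m≤n+m (bound σ) v)) σy≡)
    ...   | no _ = m+n∸n≡m v (bound σ)

  InvariantAt-generic : ∀ {σ σ' ν} → SameType σ σ' →
                        InvariantAt 𝒮 s Q Σr σ ν → InvariantAt 𝒮 s Q Σr σ' ν
  InvariantAt-generic same = InvariantAt-transport f g g∘f≗id f∘σ'≗σ
    where open Matching _ _ same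

  InvariantTy-∘ : ∀ {τ σ μ ν} → Shuffle 𝒮 s Q μ → Shuffle 𝒮 s Q ν → HasType 𝒮 s Q τ σ →
    InvariantTy 𝒮 s Q Σr τ μ → InvariantAt 𝒮 s Q Σr (σ ∘ μ) ν → InvariantTy 𝒮 s Q Σr τ (μ ∘ ν)
  InvariantTy-∘ {μ = μ} {ν} shμ shν σ:τ invμ invν σ' σ':τ C c cs sat =
    Sat-rename⁺ (μ ∘ ν) CanCtxt′ (shuffle-∘ shμ shν)
      (Sat-rename⁻ ν CanCtxt′ shν
        (InvariantAt-generic (sameType-shuffle shμ (HasType-sameType σ:τ σ':τ)) invν C c cs
          (Sat-rename⁻ μ CanCtxt′ shμ (invμ σ' σ':τ C c cs sat))))
    where
    CanCtxt′ : List (Atom 𝒮)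
    CanCtxt′ = CanCtxt 𝒮 s Q

  InvariantTy-id : ∀ τ → InvariantTy 𝒮 s Q Σr τ id
  InvariantTy-id τ σ _ C _ _ = Sat-rename⁺ id (CanCtxt 𝒮 s Q) shuffle-id

  typeOf : Binding → Var → Var → Bool
  typeOf σ x y = does (σ x ℕ.≟ σ y)

  typeOf-HasType : ∀ σ → HasType 𝒮 s Q (typeOf σ) σ
  typeOf-HasType σ x y _ _ = dec-true (σ x ℕ.≟ σ y) , does-true (σ x ℕ.≟ σ y)

  HasType⇒EqType : ∀ {τ σ} → HasType 𝒮 s Q τ σ → EqType 𝒮 s Q τ
  HasType⇒EqType σ:τ =
    (λ x x∈ → proj₁ (σ:τ x x x∈ x∈) refl) ,
    (λ x y x∈ y∈ xy → proj₁ (σ:τ y x y∈ x∈) (sym (proj₂ (σ:τ x y x∈ y∈) xy))) ,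
    (λ x y z x∈ y∈ z∈ xy yz → proj₁ (σ:τ x z x∈ z∈)
       (trans (proj₂ (σ:τ x y x∈ y∈) xy) (proj₂ (σ:τ y z y∈ z∈) yz)))

module Directions (𝒮 : DSchema) (s : Fin (DSchema.nsrc 𝒮)) (Q : CQ 𝒮) (Σr : Rule 𝒮 → Set) where
  open Satisfaction 𝒮 s Q
  open Invariance 𝒮 s Q Σr

  ShuffleInto : Instance 𝒮 → Instance 𝒮 → Set
  ShuffleInto I₁ I₂ = ∀ σ → Sat 𝒮 s Q I₁ σ (CanV 𝒮 s Q) →
    ∃[ μ ] (Shuffle 𝒮 s Q μ × InvariantAt 𝒮 s Q Σr σ μ × Sat 𝒮 s Q I₂ σ (rename 𝒮 s Q μ (CanV 𝒮 s Q)))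

  ViewsInto : Instance 𝒮 → Instance 𝒮 → Set
  ViewsInto I₁ I₂ = ∀ τ → EqType 𝒮 s Q τ → ∀ σ →
    ViewOutput 𝒮 s Q Σr τ I₁ σ → ViewOutput 𝒮 s Q Σr τ I₂ σ

  shuffles⇒views : ∀ {I₁ I₂} → ShuffleInto I₁ I₂ → ViewsInto I₁ I₂
  shuffles⇒views shuffle τ _ σ (σ:τ , μ , shμ , invμ , satμ)
    with shuffle (σ ∘ μ) (Sat-rename⁻ μ (CanV 𝒮 s Q) shμ satμ)
  ... | ν , shν , invν , satν =
    σ:τ , μ ∘ ν , shuffle-∘ shμ shν , InvariantTy-∘ shμ shν σ:τ invμ invν ,
    Sat-rename⁺ (μ ∘ ν) (CanV 𝒮 s Q) (shuffle-∘ shμ shν) (Sat-rename⁻ ν (CanV 𝒮 s Q) shν satν)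

  views⇒shuffles : ∀ {I₁ I₂} → ViewsInto I₁ I₂ → ShuffleInto I₁ I₂
  views⇒shuffles views σ sat
    with views (typeOf σ) (HasType⇒EqType (typeOf-HasType σ)) σ
           (typeOf-HasType σ , id , shuffle-id , InvariantTy-id (typeOf σ) ,
            Sat-rename⁺ id (CanV 𝒮 s Q) shuffle-id sat)
  ... | σ:τ , μ , shμ , invμ , satμ = μ , shμ , invμ σ σ:τ , satμ

mainTheorem10 : (𝒮 : DSchema) (Q : CQ 𝒮) (s : Fin (DSchema.nsrc 𝒮))
    (Σr : Rule 𝒮 → Set) → (∀ r → Σr r → LocalRule 𝒮 r) →
    (I₁ I₂ : Instance 𝒮) → SInstance 𝒮 s I₁ → SInstance 𝒮 s I₂ →
    (ShuffleEquiv 𝒮 s Q Σr I₁ I₂ → AgreeOnViews 𝒮 s Q Σr I₁ I₂)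
    × (AgreeOnViews 𝒮 s Q Σr I₁ I₂ → ShuffleEquiv 𝒮 s Q Σr I₁ I₂)
mainTheorem10 𝒮 Q s Σr _ I₁ I₂ _ _ =
  (λ (into , back) τ τ-eq σ →
     shuffles⇒views into τ τ-eq σ , shuffles⇒views back τ τ-eq σ) ,
  (λ agree →
     views⇒shuffles (λ τ τ-eq σ → proj₁ (agree τ τ-eq σ)) ,
     views⇒shuffles (λ τ τ-eq σ → proj₂ (agree τ τ-eq σ)))
  where open Directions 𝒮 s Q Σr
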